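{- For integers $n,k\ge1$ with $n\ge k+1$, the number of permutations $\sigma$ of $[n]$ with exactly $k$ extreme elements equals $2^k c(n-1,k)$.
   Context: For $\sigma=\sigma_1\cdots\sigma_n$, $\sigma_i$ is a left-to-right minimum (resp. maximum) if $\sigma_i<\sigma_j$ (resp. $\sigma_i>\sigma_j$) for all $j<i$. For $i\ge2$, $\sigma_i$ is an extreme element if it is a left-to-right minimum or a left-to-right maximum (position $1$ is never counted). $c(n,k)$ denotes the signless Stirling number of the first kind, the number of permutations of $[n]$ with exactly $k$ cycles. -}

module Defs where

open import Data.Nat using (ℕ; zero; suc; _+_; _<_; _≤_)
open import Data.Nat.Properties using (_<?_; _≤?_; _≟_)
open import Data.Fin using (Fin; toℕ)
open import Data.Vec using (Vec; []; _∷_; lookup; toList)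
open import Data.List using (List; []; _∷_; length; filter; concatMap; map; allFin; upTo)
open import Data.List.Relation.Unary.All using (All)
open import Data.List.Relation.Unary.All.Properties using ()
import Data.List.Relation.Unary.All as All
open import Data.List.Relation.Unary.Unique.Propositional using (Unique)
open import Data.List.Relation.Unary.Unique.Propositional.Properties using ()
open import Data.Fin.Properties using () renaming (_≟_ to _≟F_)
open import Data.List.Relation.Unary.AllPairs using (allPairs?)
open import Relation.Nullary using (¬_; Dec)
open import Relation.Nullary.Decidable using (¬?; _×-dec_; _⊎-dec_)
open import Relation.Binary.PropositionalEquality using (_≡_)
open import Data.Product using (_×_)
open import Data.Sum using (_⊎_)

-- A permutation σ of [n] = {1..n} is represented by its one-line notation
-- σ₁ ⋯ σₙ, i.e. a vector of length n over Fin n (value j stands for j+1)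
-- with no repeated entries.

allVecs : (n m : ℕ) → List (Vec (Fin n) m)
allVecs n zero    = [] ∷ []
allVecs n (suc m) = concatMap (λ x → map (x ∷_) (allVecs n m)) (allFin n)

IsPerm : {n : ℕ} → Vec (Fin n) n → Set
IsPerm v = Unique (toList v)

isPerm? : {n : ℕ} → (v : Vec (Fin n) n) → Dec (IsPerm v)
isPerm? v = allPairs? (λ x y → ¬? (x ≟F y)) (toList v)

perms : (n : ℕ) → List (Vec (Fin n) n)
perms n = filter isPerm? (allVecs n n)

countPerms : (n : ℕ) → {P : Vec (Fin n) n → Set} →
             ((v : Vec (Fin n) n) → Dec (P v)) → ℕ
countPerms n P? = length (filter P? (perms n))

IsLRMin : {n : ℕ} → Vec (Fin n) n → Fin n → Set
IsLRMin v i = All (λ j → toℕ (lookup v i) < toℕ (lookup v j))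
                  (filter (λ j → toℕ j <? toℕ i) (allFin _))

IsLRMax : {n : ℕ} → Vec (Fin n) n → Fin n → Set
IsLRMax v i = All (λ j → toℕ (lookup v j) < toℕ (lookup v i))
                  (filter (λ j → toℕ j <? toℕ i) (allFin _))

isLRMin? : {n : ℕ} → (v : Vec (Fin n) n) → (i : Fin n) → Dec (IsLRMin v i)
isLRMin? v i = All.all? (λ j → toℕ (lookup v i) <? toℕ (lookup v j)) _

isLRMax? : {n : ℕ} → (v : Vec (Fin n) n) → (i : Fin n) → Dec (IsLRMax v i)
isLRMax? v i = All.all? (λ j → toℕ (lookup v j) <? toℕ (lookup v i)) _

-- position i (0-based) is extreme: i ≥ 1 (1-based position ≥ 2) and
-- σ_i is a left-to-right minimum or a left-to-right maximum
IsExtreme : {n : ℕ} → Vec (Fin n) n → Fin n → Set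
IsExtreme v i = 1 ≤ toℕ i × (IsLRMin v i ⊎ IsLRMax v i)

isExtreme? : {n : ℕ} → (v : Vec (Fin n) n) → (i : Fin n) → Dec (IsExtreme v i)
isExtreme? v i = (1 ≤? toℕ i) ×-dec (isLRMin? v i ⊎-dec isLRMax? v i)

extremes : {n : ℕ} → Vec (Fin n) n → ℕ
extremes v = length (filter (isExtreme? v) (allFin _))

iter : {n : ℕ} → Vec (Fin n) n → ℕ → Fin n → Fin n
iter v zero    i = i
iter v (suc m) i = lookup v (iter v m i)

-- i is the least element of its cycle: σ^m(i) ≥ i for all m < n
-- (the orbit of i has at most n elements, so this covers the whole cycle)
IsCycleMin : {n : ℕ} → Vec (Fin n) n → Fin n → Set
IsCycleMin {n} v i = All (λ m → toℕ i ≤ toℕ (iter v m i)) (upTo n)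

isCycleMin? : {n : ℕ} → (v : Vec (Fin n) n) → (i : Fin n) → Dec (IsCycleMin v i)
isCycleMin? {n} v i = All.all? (λ m → toℕ i ≤? toℕ (iter v m i)) (upTo n)

-- number of cycles of σ = number of cycle minima
cycles : {n : ℕ} → Vec (Fin n) n → ℕ
cycles v = length (filter (isCycleMin? v) (allFin _))

stirling1 : ℕ → ℕ → ℕ
stirling1 n k = countPerms n (λ v → cycles v ≟ k)

module Submission where

-- Write E(n,k) for the number of permutations of [n] with k extreme elements
-- and c(n,k) for the number with k cycles.
--
-- Both numbers obey a recurrence coming from one bijection (module Insertion):
-- a permutation of [n+1] is a permutation τ of [n] together with its last
-- value j, the values of τ being re-embedded into [n+1] ∖ {j} by a chosen
-- family of injections.  If a statistic grows by one for exactly s values of j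
-- and is unchanged otherwise, then D(n+1,k) = s D(n,k-1) + (n+1-s) D(n,k)
-- (insertion-recurrence).  For cycles the re-embedding puts n+1 into the cycle
-- of τ just before j, creating a new cycle iff j = n+1, so
-- c(n+1,k) = c(n,k-1) + n c(n,k).  For extreme elements it shifts the values
-- ≥ j up by one; the old entries keep their status and the new last entry is
-- extreme iff j is the least or the greatest value, so for n ≥ 1
-- E(n+1,k) = 2 E(n,k-1) + (n-1) E(n,k).  Induction on q then gives the formula.

open import Defs
open import Data.Nat using (ℕ; zero; suc; _+_; _∸_; _^_; _*_; _≤_; _<_; _>_; z≤n; s≤s)
open import Data.Nat.Properties using (_≟_; _<?_)
import Data.Nat.Properties as ℕP
open import Data.Nat.DivMod using (_%_; _/_; m%n<n; m≡m%n+[m/n]*n)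
open import Data.Nat.Solver using (module +-*-Solver)
open import Data.Fin as Fin using (Fin; toℕ; fromℕ; inject₁; punchIn; punchOut)
import Data.Fin.Properties as FinP
open import Data.Vec as Vec using (Vec; lookup; toList; _∷ʳ_)
open import Data.Fin.Relation.Unary.Top using (View; view; ‵fromℕ; ‵inject₁)
import Data.Vec.Properties as VecP
open import Data.List as List using (List; []; _∷_; length; filter; map; allFin; cartesianProduct; _++_)
import Data.List.Properties as ListP
open import Data.List.Relation.Unary.All as All using (All)
open import Data.List.Relation.Unary.Any as Any using (here; there)
import Data.List.Relation.Unary.AllPairs as AllPairs
import Data.List.Relation.Unary.AllPairs.Properties as AllPairsP
open import Data.List.Relation.Unary.Unique.Propositional using (Unique)
import Data.List.Relation.Unary.Unique.Propositional.Properties as UniqueP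
open import Data.List.Membership.Propositional using (_∈_)
import Data.List.Membership.Propositional.Properties as ∈P
open import Data.List.Membership.Propositional.Properties.WithK using (unique∧set⇒bag)
open import Data.List.Relation.Binary.BagAndSetEquality using (∼bag⇒↭)
open import Data.List.Relation.Binary.Permutation.Propositional using (_↭_)
import Data.List.Relation.Binary.Permutation.Propositional.Properties as ↭P
open import Data.Product using (_×_; _,_; proj₁; proj₂; ∃; ∃₂; uncurry)
open import Data.Sum using (_⊎_; inj₁; inj₂)
open import Function using (_∘_; _⇔_; mk⇔; Equivalence)
open import Function.Construct.Composition using (_⇔-∘_)
open import Data.Product.Function.NonDependent.Propositional using (_×-⇔_)
open import Data.Sum.Function.Propositional using (_⊎-⇔_)
open import Function.Definitions using (Injective)
open import Relation.Nullary using (¬_; Dec; yes; no; contradiction)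
open import Relation.Nullary.Decidable using (¬?; _⊎-dec_)
open import Relation.Unary using (Decidable)
open import Relation.Binary.PropositionalEquality

open Equivalence using (to; from)

ind : {P : Set} → Dec P → ℕ
ind (yes _) = 1
ind (no _)  = 0

cnt : {A : Set} {P : A → Set} → Decidable P → List A → ℕ
cnt P? []       = 0
cnt P? (x ∷ xs) = ind (P? x) + cnt P? xs

length-filter≡cnt : {A : Set} {P : A → Set} (P? : Decidable P) (xs : List A) →
                    length (filter P? xs) ≡ cnt P? xs
length-filter≡cnt P? []       = refl
length-filter≡cnt P? (x ∷ xs) with P? x
... | yes _ = cong suc (length-filter≡cnt P? xs)
... | no _  = length-filter≡cnt P? xs

ind-cong : {P Q : Set} (P? : Dec P) (Q? : Dec Q) → P ⇔ Q → ind P? ≡ ind Q?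
ind-cong (yes _) (yes _) _   = refl
ind-cong (yes p) (no ¬q) P⇔Q = contradiction (to P⇔Q p) ¬q
ind-cong (no ¬p) (yes q) P⇔Q = contradiction (from P⇔Q q) ¬p
ind-cong (no _)  (no _)  _   = refl

ind-yes : {P : Set} (P? : Dec P) → P → ind P? ≡ 1
ind-yes (yes _) _ = refl
ind-yes (no ¬p) p = contradiction p ¬p

cnt-cong : {A : Set} {P Q : A → Set} (P? : Decidable P) (Q? : Decidable Q) →
           (∀ x → P x ⇔ Q x) → (xs : List A) → cnt P? xs ≡ cnt Q? xs
cnt-cong P? Q? P⇔Q []       = refl
cnt-cong P? Q? P⇔Q (x ∷ xs) = cong₂ _+_ (ind-cong (P? x) (Q? x) (P⇔Q x)) (cnt-cong P? Q? P⇔Q xs)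

cnt-none : {A : Set} {P : A → Set} (P? : Decidable P) → (∀ x → ¬ P x) → (xs : List A) → cnt P? xs ≡ 0
cnt-none P? ¬P []       = refl
cnt-none P? ¬P (x ∷ xs) with P? x
... | yes p = contradiction p (¬P x)
... | no _  = cnt-none P? ¬P xs

cnt-++ : {A : Set} {P : A → Set} (P? : Decidable P) (xs ys : List A) →
         cnt P? (xs ++ ys) ≡ cnt P? xs + cnt P? ys
cnt-++ P? []       ys = refl
cnt-++ P? (x ∷ xs) ys = trans (cong (ind (P? x) +_) (cnt-++ P? xs ys)) (sym (ℕP.+-assoc (ind (P? x)) _ _))

cnt-map : {A B : Set} {P : B → Set} (P? : Decidable P) (f : A → B) (xs : List A) →
          cnt P? (map f xs) ≡ cnt (P? ∘ f) xs
cnt-map P? f []       = refl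
cnt-map P? f (x ∷ xs) = cong (ind (P? (f x)) +_) (cnt-map P? f xs)

cnt-↭ : {A : Set} {P : A → Set} (P? : Decidable P) {xs ys : List A} → xs ↭ ys → cnt P? xs ≡ cnt P? ys
cnt-↭ P? {xs} {ys} xs↭ys = begin
  cnt P? xs              ≡⟨ sym (length-filter≡cnt P? xs) ⟩
  length (filter P? xs)  ≡⟨ ↭P.↭-length (↭P.filter-↭ P? xs↭ys) ⟩
  length (filter P? ys)  ≡⟨ length-filter≡cnt P? ys ⟩
  cnt P? ys              ∎
  where open ≡-Reasoning

cnt-complement : {A : Set} {P : A → Set} (P? : Decidable P) (xs : List A) →
                 cnt P? xs + cnt (¬? ∘ P?) xs ≡ length xs
cnt-complement P? []       = refl
cnt-complement P? (x ∷ xs) with P? x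
... | yes _ = cong suc (cnt-complement P? xs)
... | no _  = trans (ℕP.+-suc (cnt P? xs) _) (cong suc (cnt-complement P? xs))

cnt-split : {A : Set} {P : A → Set} (P? : Decidable P) (m k : ℕ) (xs : List A) →
            cnt (λ x → ind (P? x) + m ≟ k) xs
              ≡ cnt P? xs * ind (suc m ≟ k) + cnt (¬? ∘ P?) xs * ind (m ≟ k)
cnt-split P? m k []       = refl
cnt-split P? m k (x ∷ xs) with P? x
... | yes _ = trans (cong (ind (suc m ≟ k) +_) (cnt-split P? m k xs))
                    (sym (ℕP.+-assoc (ind (suc m ≟ k)) _ _))
... | no _  = trans (cong (ind (m ≟ k) +_) (cnt-split P? m k xs))
                    (solve 4 (λ a b c d → b :+ (c :* a :+ d) := c :* a :+ (b :+ d)) refl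
                       (ind (suc m ≟ k)) (ind (m ≟ k)) (cnt P? xs) (cnt (¬? ∘ P?) xs * ind (m ≟ k)))
  where open +-*-Solver

cnt-cartesianProduct : {A B : Set} {Q : A × B → Set} {P₁ P₂ : A → Set}
  (Q? : Decidable Q) (P₁? : Decidable P₁) (P₂? : Decidable P₂) (c₁ c₂ : ℕ) (xs : List A) (zs : List B) →
  (∀ x → x ∈ xs → cnt (λ z → Q? (x , z)) zs ≡ c₁ * ind (P₁? x) + c₂ * ind (P₂? x)) →
  cnt Q? (cartesianProduct xs zs) ≡ c₁ * cnt P₁? xs + c₂ * cnt P₂? xs
cnt-cartesianProduct Q? P₁? P₂? c₁ c₂ []       zs fibre = sym (cong₂ _+_ (ℕP.*-zeroʳ c₁) (ℕP.*-zeroʳ c₂))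
cnt-cartesianProduct Q? P₁? P₂? c₁ c₂ (x ∷ xs) zs fibre = begin
  cnt Q? (map (x ,_) zs ++ cartesianProduct xs zs)
    ≡⟨ cnt-++ Q? (map (x ,_) zs) _ ⟩
  cnt Q? (map (x ,_) zs) + cnt Q? (cartesianProduct xs zs)
    ≡⟨ cong₂ _+_ (trans (cnt-map Q? (x ,_) zs) (fibre x (here refl)))
                 (cnt-cartesianProduct Q? P₁? P₂? c₁ c₂ xs zs (λ y y∈ → fibre y (there y∈))) ⟩
  (c₁ * a₁ + c₂ * a₂) + (c₁ * b₁ + c₂ * b₂)
    ≡⟨ solve 6 (λ c₁ c₂ a₁ a₂ b₁ b₂ → (c₁ :* a₁ :+ c₂ :* a₂) :+ (c₁ :* b₁ :+ c₂ :* b₂)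
                                   := c₁ :* (a₁ :+ b₁) :+ c₂ :* (a₂ :+ b₂)) refl c₁ c₂ a₁ a₂ b₁ b₂ ⟩
  c₁ * (a₁ + b₁) + c₂ * (a₂ + b₂) ∎
  where
  open ≡-Reasoning
  open +-*-Solver
  a₁ a₂ b₁ b₂ : ℕ
  a₁ = ind (P₁? x)
  a₂ = ind (P₂? x)
  b₁ = cnt P₁? xs
  b₂ = cnt P₂? xs

allFin-suc : (n : ℕ) → allFin (suc n) ≡ Fin.zero ∷ map Fin.suc (allFin n)
allFin-suc n = cong (Fin.zero ∷_) (sym (ListP.map-tabulate (λ i → i) Fin.suc))

tabulate-last : {A : Set} (n : ℕ) (f : Fin (suc n) → A) →
                List.tabulate f ≡ List.tabulate (f ∘ inject₁) ++ f (fromℕ n) ∷ []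
tabulate-last zero    f = refl
tabulate-last (suc n) f = cong (f Fin.zero ∷_) (tabulate-last n (f ∘ Fin.suc))

allFin-last : (n : ℕ) → allFin (suc n) ≡ map inject₁ (allFin n) ++ fromℕ n ∷ []
allFin-last n = trans (tabulate-last n (λ i → i))
                      (cong (_++ fromℕ n ∷ []) (sym (ListP.map-tabulate (λ i → i) inject₁)))

cnt-allFin-suc : {n : ℕ} {P : Fin (suc n) → Set} (P? : Decidable P) →
                 cnt P? (allFin (suc n)) ≡ ind (P? Fin.zero) + cnt (P? ∘ Fin.suc) (allFin n)
cnt-allFin-suc {n} P? = trans (cong (cnt P?) (allFin-suc n))
                              (cong (ind (P? Fin.zero) +_) (cnt-map P? Fin.suc (allFin n)))

cnt-allFin-last : {n : ℕ} {P : Fin (suc n) → Set} (P? : Decidable P) →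
                  cnt P? (allFin (suc n)) ≡ cnt (P? ∘ inject₁) (allFin n) + ind (P? (fromℕ n))
cnt-allFin-last {n} P? = begin
  cnt P? (allFin (suc n))                                  ≡⟨ cong (cnt P?) (allFin-last n) ⟩
  cnt P? (map inject₁ (allFin n) ++ fromℕ n ∷ [])          ≡⟨ cnt-++ P? (map inject₁ (allFin n)) _ ⟩
  cnt P? (map inject₁ (allFin n)) + (ind (P? (fromℕ n)) + 0)
    ≡⟨ cong₂ _+_ (cnt-map P? inject₁ (allFin n)) (ℕP.+-identityʳ _) ⟩
  cnt (P? ∘ inject₁) (allFin n) + ind (P? (fromℕ n))        ∎
  where open ≡-Reasoning

cnt-positions-last : {n : ℕ} {P : Fin (suc n) → Set} {Q : Fin n → Set} {S : Set}
  (P? : Decidable P) (Q? : Decidable Q) (S? : Dec S) →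
  (∀ x → P (inject₁ x) ⇔ Q x) → P (fromℕ n) ⇔ S →
  length (filter P? (allFin (suc n))) ≡ ind S? + length (filter Q? (allFin n))
cnt-positions-last {n} P? Q? S? inner lastPos = begin
  length (filter P? (allFin (suc n)))                 ≡⟨ length-filter≡cnt P? (allFin (suc n)) ⟩
  cnt P? (allFin (suc n))                             ≡⟨ cnt-allFin-last P? ⟩
  cnt (P? ∘ inject₁) (allFin n) + ind (P? (fromℕ n))
    ≡⟨ cong₂ _+_ (cnt-cong (P? ∘ inject₁) Q? inner (allFin n)) (ind-cong (P? (fromℕ n)) S? lastPos) ⟩
  cnt Q? (allFin n) + ind S?                          ≡⟨ ℕP.+-comm (cnt Q? (allFin n)) (ind S?) ⟩
  ind S? + cnt Q? (allFin n)                          ≡⟨ cong (ind S? +_) (sym (length-filter≡cnt Q? (allFin n))) ⟩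
  ind S? + length (filter Q? (allFin n))              ∎
  where open ≡-Reasoning

Inj : {n : ℕ} → Vec (Fin n) n → Set
Inj v = Injective _≡_ _≡_ (lookup v)

All-toList⁻ : {A : Set} {P : A → Set} {n : ℕ} (v : Vec A n) → All P (toList v) → ∀ i → P (lookup v i)
All-toList⁻ (x Vec.∷ v) (px All.∷ _)  Fin.zero    = px
All-toList⁻ (x Vec.∷ v) (_  All.∷ pv) (Fin.suc i) = All-toList⁻ v pv i

All-toList⁺ : {A : Set} {P : A → Set} {n : ℕ} (v : Vec A n) → (∀ i → P (lookup v i)) → All P (toList v)
All-toList⁺ Vec.[]      h = All.[]
All-toList⁺ (x Vec.∷ v) h = h Fin.zero All.∷ All-toList⁺ v (h ∘ Fin.suc)

unique⇒injective : {A : Set} {n : ℕ} (v : Vec A n) → Unique (toList v) → Injective _≡_ _≡_ (lookup v)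
unique⇒injective (x Vec.∷ v) (_ AllPairs.∷ _) {Fin.zero}  {Fin.zero}  _ = refl
unique⇒injective (x Vec.∷ v) (h AllPairs.∷ _) {Fin.zero}  {Fin.suc j} e = contradiction e (All-toList⁻ v h j)
unique⇒injective (x Vec.∷ v) (h AllPairs.∷ _) {Fin.suc i} {Fin.zero}  e = contradiction (sym e) (All-toList⁻ v h i)
unique⇒injective (x Vec.∷ v) (_ AllPairs.∷ u) {Fin.suc i} {Fin.suc j} e = cong Fin.suc (unique⇒injective v u e)

injective⇒unique : {A : Set} {n : ℕ} (v : Vec A n) → Injective _≡_ _≡_ (lookup v) → Unique (toList v)
injective⇒unique Vec.[]      inj = AllPairs.[]
injective⇒unique (x Vec.∷ v) inj =
  All-toList⁺ v (λ i e → FinP.0≢1+n (inj e)) AllPairs.∷ injective⇒unique v (FinP.suc-injective ∘ inj)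

∈-allVecs : (n m : ℕ) (v : Vec (Fin n) m) → v ∈ allVecs n m
∈-allVecs n zero    Vec.[]      = here refl
∈-allVecs n (suc m) (x Vec.∷ v) = ∈P.∈-concatMap⁺ (λ y → map (y Vec.∷_) (allVecs n m))
  (Any.map (λ { refl → ∈P.∈-map⁺ (x Vec.∷_) (∈-allVecs n m v) }) (∈P.∈-allFin x))

unique-allVecs : (n m : ℕ) → Unique (allVecs n m)
unique-allVecs n zero    = All.[] AllPairs.∷ AllPairs.[]
unique-allVecs n (suc m) = UniqueP.concat⁺ (All.tabulate block-unique)
  (AllPairsP.map⁺ (AllPairs.map (λ x≢y {v} (v∈x , v∈y) → x≢y (trans (sym (head∈ v∈x)) (head∈ v∈y)))
                                (UniqueP.allFin⁺ n)))
  where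
  block-unique : ∀ {vs} → vs ∈ map (λ x → map (x Vec.∷_) (allVecs n m)) (allFin n) → Unique vs
  block-unique vs∈ with ∈P.∈-map⁻ _ vs∈
  ... | x , _ , refl = UniqueP.map⁺ VecP.∷-injectiveʳ (unique-allVecs n m)
  head∈ : ∀ {x} {v : Vec (Fin n) (suc m)} → v ∈ map (x Vec.∷_) (allVecs n m) → Vec.head v ≡ x
  head∈ v∈ with ∈P.∈-map⁻ _ v∈
  ... | _ , _ , refl = refl

∈-perms⁺ : {n : ℕ} (v : Vec (Fin n) n) → Inj v → v ∈ perms n
∈-perms⁺ {n} v inj = ∈P.∈-filter⁺ isPerm? (∈-allVecs n n v) (injective⇒unique v inj)

∈-perms⁻ : {n : ℕ} {v : Vec (Fin n) n} → v ∈ perms n → Inj v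
∈-perms⁻ {n} {v} v∈ = unique⇒injective v (proj₂ (∈P.∈-filter⁻ isPerm? {xs = allVecs n n} v∈))

unique-perms : (n : ℕ) → Unique (perms n)
unique-perms n = UniqueP.filter⁺ isPerm? (unique-allVecs n n)

vec-ext : {A : Set} {n : ℕ} (xs ys : Vec A n) → (∀ i → lookup xs i ≡ lookup ys i) → xs ≡ ys
vec-ext xs ys h = trans (sym (VecP.tabulate∘lookup xs)) (trans (VecP.tabulate-cong h) (VecP.tabulate∘lookup ys))

lookup-∷ʳ-last : {A : Set} {n : ℕ} (xs : Vec A n) (x : A) → lookup (xs ∷ʳ x) (fromℕ n) ≡ x
lookup-∷ʳ-last Vec.[]       x = refl
lookup-∷ʳ-last (y Vec.∷ xs) x = lookup-∷ʳ-last xs x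

lookup-∷ʳ-inject₁ : {A : Set} {n : ℕ} (xs : Vec A n) (x : A) (i : Fin n) →
                    lookup (xs ∷ʳ x) (inject₁ i) ≡ lookup xs i
lookup-∷ʳ-inject₁ (y Vec.∷ xs) x Fin.zero    = refl
lookup-∷ʳ-inject₁ (y Vec.∷ xs) x (Fin.suc i) = lookup-∷ʳ-inject₁ xs x i

injective⇒surjective : {n : ℕ} (f : Fin n → Fin n) → Injective _≡_ _≡_ f → ∀ a → ∃ λ x → f x ≡ a
injective⇒surjective {suc n} f f-inj a with FinP.any? (λ x → f x FinP.≟ a)
... | yes hit = hit
... | no miss = contradiction (FinP.injective⇒≤ squeeze-inj) ℕP.1+n≰n
  where
  -- f with the missed value a squeezed out, an injection Fin (suc n) → Fin n
  squeeze : Fin (suc n) → Fin n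
  squeeze x = punchOut {i = a} {j = f x} (λ a≡fx → miss (x , sym a≡fx))
  squeeze-inj : Injective _≡_ _≡_ squeeze
  squeeze-inj {x} {y} e =
    f-inj (FinP.punchOut-injective (λ a≡fx → miss (x , sym a≡fx)) (λ a≡fy → miss (y , sym a≡fy)) e)

Statistic : Set
Statistic = ∀ {m} → Vec (Fin m) m → ℕ

distribution : Statistic → ℕ → ℕ → ℕ
distribution stat n k = countPerms n (λ σ → stat σ ≟ k)

raised : Statistic → ℕ → ℕ → ℕ
raised stat n k = cnt (λ σ → suc (stat σ) ≟ k) (perms n)

raised-zero : (stat : Statistic) (n : ℕ) → raised stat n 0 ≡ 0
raised-zero stat n = cnt-none (λ σ → suc (stat σ) ≟ 0) (λ σ ()) (perms n)

raised-suc : (stat : Statistic) (n k : ℕ) → raised stat n (suc k) ≡ distribution stat n k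
raised-suc stat n k = trans
  (cnt-cong (λ σ → suc (stat σ) ≟ suc k) (λ σ → stat σ ≟ k) (λ σ → mk⇔ ℕP.suc-injective (cong suc)) (perms n))
  (sym (length-filter≡cnt (λ σ → stat σ ≟ k) (perms n)))

module Insertion {n : ℕ}
  (embed : Fin (suc n) → Fin n → Fin (suc n))
  (embed-avoids : ∀ j y → embed j y ≢ j)
  (embed-injective : ∀ j → Injective _≡_ _≡_ (embed j)) where

  insert : Vec (Fin n) n → Fin (suc n) → Vec (Fin (suc n)) (suc n)
  insert τ j = Vec.map (embed j) τ ∷ʳ j

  insert-last : ∀ τ j → lookup (insert τ j) (fromℕ n) ≡ j
  insert-last τ j = lookup-∷ʳ-last (Vec.map (embed j) τ) j

  insert-inject₁ : ∀ τ j x → lookup (insert τ j) (inject₁ x) ≡ embed j (lookup τ x)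
  insert-inject₁ τ j x =
    trans (lookup-∷ʳ-inject₁ (Vec.map (embed j) τ) j x) (VecP.lookup-map x (embed j) τ)

  -- embed j followed by punching out j: an injection, hence a bijection, of Fin n
  compress : Fin (suc n) → Fin n → Fin n
  compress j y = punchOut (embed-avoids j y ∘ sym)

  compress-injective : ∀ j → Injective _≡_ _≡_ (compress j)
  compress-injective j {x} {y} e =
    embed-injective j (FinP.punchOut-injective (embed-avoids j x ∘ sym) (embed-avoids j y ∘ sym) e)

  embed-onto : ∀ j a → a ≢ j → ∃ λ y → embed j y ≡ a
  embed-onto j a a≢j = y , (begin
    embed j y                         ≡⟨ sym (FinP.punchIn-punchOut (embed-avoids j y ∘ sym)) ⟩
    punchIn j (compress j y)          ≡⟨ cong (punchIn j) compress≡ ⟩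
    punchIn j (punchOut (a≢j ∘ sym))  ≡⟨ FinP.punchIn-punchOut (a≢j ∘ sym) ⟩
    a                                 ∎)
    where
    open ≡-Reasoning
    preimage : ∃ λ y → compress j y ≡ punchOut (a≢j ∘ sym)
    preimage = injective⇒surjective (compress j) (compress-injective j) (punchOut (a≢j ∘ sym))
    y : Fin n
    y = proj₁ preimage
    compress≡ : compress j y ≡ punchOut (a≢j ∘ sym)
    compress≡ = proj₂ preimage

  insert-injective : Injective _≡_ _≡_ (uncurry insert)
  insert-injective {τ , j} {τ′ , j′} e with VecP.∷ʳ-injective _ _ e
  ... | map≡ , refl = cong (_, j) (vec-ext τ τ′ λ x → embed-injective j (begin
    embed j (lookup τ x)             ≡⟨ sym (VecP.lookup-map x (embed j) τ) ⟩
    lookup (Vec.map (embed j) τ) x   ≡⟨ cong (λ v → lookup v x) map≡ ⟩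
    lookup (Vec.map (embed j) τ′) x  ≡⟨ VecP.lookup-map x (embed j) τ′ ⟩
    embed j (lookup τ′ x)            ∎))
    where open ≡-Reasoning

  insert-Inj : ∀ τ j → Inj τ → Inj (insert τ j)
  insert-Inj τ j τ-inj {p} {q} e with view p | view q
  ... | ‵fromℕ     | ‵fromℕ     = refl
  ... | ‵fromℕ     | ‵inject₁ y = contradiction
    (trans (sym (insert-inject₁ τ j y)) (trans (sym e) (insert-last τ j))) (embed-avoids j (lookup τ y))
  ... | ‵inject₁ x | ‵fromℕ     = contradiction
    (trans (sym (insert-inject₁ τ j x)) (trans e (insert-last τ j))) (embed-avoids j (lookup τ x))
  ... | ‵inject₁ x | ‵inject₁ y = cong inject₁ (τ-inj (embed-injective j
    (trans (sym (insert-inject₁ τ j x)) (trans e (insert-inject₁ τ j y)))))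

  insert-onto : ∀ σ → Inj σ → ∃₂ λ τ j → Inj τ × insert τ j ≡ σ
  insert-onto σ σ-inj with Vec.initLast σ
  ... | ys , j , refl = τ , j , τ-inj , cong (_∷ʳ j) (vec-ext _ ys map-τ)
    where
    entry : ∀ x → lookup ys x ≡ lookup (ys ∷ʳ j) (inject₁ x)
    entry x = sym (lookup-∷ʳ-inject₁ ys j x)
    entry≢last : ∀ x → lookup ys x ≢ j
    entry≢last x e =
      FinP.fromℕ≢inject₁ (sym (σ-inj (trans (sym (entry x)) (trans e (sym (lookup-∷ʳ-last ys j))))))
    τ : Vec (Fin n) n
    τ = Vec.tabulate λ x → proj₁ (embed-onto j (lookup ys x) (entry≢last x))
    embed-τ : ∀ x → embed j (lookup τ x) ≡ lookup ys x
    embed-τ x = trans (cong (embed j) (VecP.lookup∘tabulate _ x))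
                      (proj₂ (embed-onto j (lookup ys x) (entry≢last x)))
    map-τ : ∀ x → lookup (Vec.map (embed j) τ) x ≡ lookup ys x
    map-τ x = trans (VecP.lookup-map x (embed j) τ) (embed-τ x)
    τ-inj : Inj τ
    τ-inj {x} {y} e = FinP.inject₁-injective (σ-inj (begin
      lookup (ys ∷ʳ j) (inject₁ x)   ≡⟨ sym (entry x) ⟩
      lookup ys x                   ≡⟨ sym (embed-τ x) ⟩
      embed j (lookup τ x)          ≡⟨ cong (embed j) e ⟩
      embed j (lookup τ y)          ≡⟨ embed-τ y ⟩
      lookup ys y                   ≡⟨ entry y ⟩
      lookup (ys ∷ʳ j) (inject₁ y)   ∎))
      where open ≡-Reasoning

  pairs : List (Vec (Fin n) n × Fin (suc n))
  pairs = cartesianProduct (perms n) (allFin (suc n))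

  perms↭inserts : perms (suc n) ↭ map (uncurry insert) pairs
  perms↭inserts = ∼bag⇒↭ (unique∧set⇒bag (unique-perms (suc n))
    (UniqueP.map⁺ insert-injective (UniqueP.cartesianProduct⁺ (unique-perms n) (UniqueP.allFin⁺ (suc n))))
    (mk⇔ inserted built))
    where
    inserted : ∀ {σ} → σ ∈ perms (suc n) → σ ∈ map (uncurry insert) pairs
    inserted {σ} σ∈ with insert-onto σ (∈-perms⁻ σ∈)
    ... | τ , j , τ-inj , refl =
      ∈P.∈-map⁺ (uncurry insert) (∈P.∈-cartesianProduct⁺ (∈-perms⁺ τ τ-inj) (∈P.∈-allFin j))
    built : ∀ {σ} → σ ∈ map (uncurry insert) pairs → σ ∈ perms (suc n)
    built σ∈ with ∈P.∈-map⁻ (uncurry insert) σ∈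
    ... | (τ , j) , p∈ , refl =
      ∈-perms⁺ _ (insert-Inj τ j (∈-perms⁻ (proj₁ (∈P.∈-cartesianProduct⁻ (perms n) (allFin (suc n)) p∈))))

  insertion-recurrence : (stat : Statistic) {Special : Fin (suc n) → Set} (special? : Decidable Special) →
    (∀ τ → Inj τ → ∀ j → stat (insert τ j) ≡ ind (special? j) + stat τ) →
    (s r : ℕ) → cnt special? (allFin (suc n)) ≡ s → s + r ≡ suc n →
    ∀ k → distribution stat (suc n) k ≡ s * raised stat n k + r * distribution stat n k
  insertion-recurrence stat special? stat-insert s r #special s+r k = begin
    distribution stat (suc n) k
      ≡⟨ length-filter≡cnt (λ σ → stat σ ≟ k) (perms (suc n)) ⟩
    cnt (λ σ → stat σ ≟ k) (perms (suc n))
      ≡⟨ cnt-↭ (λ σ → stat σ ≟ k) perms↭inserts ⟩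
    cnt (λ σ → stat σ ≟ k) (map (uncurry insert) pairs)
      ≡⟨ cnt-map (λ σ → stat σ ≟ k) (uncurry insert) pairs ⟩
    cnt (λ p → stat (uncurry insert p) ≟ k) pairs
      ≡⟨ cnt-cartesianProduct (λ p → stat (uncurry insert p) ≟ k) (λ τ → suc (stat τ) ≟ k)
           (λ τ → stat τ ≟ k) s r (perms n) (allFin (suc n)) (λ τ τ∈ → fibre τ (∈-perms⁻ τ∈)) ⟩
    s * raised stat n k + r * cnt (λ τ → stat τ ≟ k) (perms n)
      ≡⟨ cong (λ c → s * raised stat n k + r * c)
              (sym (length-filter≡cnt (λ τ → stat τ ≟ k) (perms n))) ⟩
    s * raised stat n k + r * distribution stat n k ∎
    where
    open ≡-Reasoning
    #allFin : length (allFin (suc n)) ≡ suc n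
    #allFin = ListP.length-tabulate (λ i → i)
    #non-special : cnt (¬? ∘ special?) (allFin (suc n)) ≡ r
    #non-special = ℕP.+-cancelˡ-≡ s _ r (begin
      s + cnt (¬? ∘ special?) (allFin (suc n))
        ≡⟨ cong (_+ cnt (¬? ∘ special?) (allFin (suc n))) (sym #special) ⟩
      cnt special? (allFin (suc n)) + cnt (¬? ∘ special?) (allFin (suc n))
        ≡⟨ cnt-complement special? (allFin (suc n)) ⟩
      length (allFin (suc n))  ≡⟨ #allFin ⟩
      suc n                    ≡⟨ sym s+r ⟩
      s + r                    ∎)
    fibre : ∀ τ → Inj τ →
      cnt (λ j → stat (insert τ j) ≟ k) (allFin (suc n))
        ≡ s * ind (suc (stat τ) ≟ k) + r * ind (stat τ ≟ k)
    fibre τ τ-inj = begin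
      cnt (λ j → stat (insert τ j) ≟ k) (allFin (suc n))
        ≡⟨ cnt-cong _ (λ j → ind (special? j) + stat τ ≟ k)
             (λ j → mk⇔ (trans (sym (stat-insert τ τ-inj j))) (trans (stat-insert τ τ-inj j)))
             (allFin (suc n)) ⟩
      cnt (λ j → ind (special? j) + stat τ ≟ k) (allFin (suc n))
        ≡⟨ cnt-split special? (stat τ) k (allFin (suc n)) ⟩
      cnt special? (allFin (suc n)) * ind (suc (stat τ) ≟ k)
        + cnt (¬? ∘ special?) (allFin (suc n)) * ind (stat τ ≟ k)
        ≡⟨ cong₂ (λ a b → a * ind (suc (stat τ) ≟ k) + b * ind (stat τ ≟ k)) #special #non-special ⟩
      s * ind (suc (stat τ) ≟ k) + r * ind (stat τ ≟ k) ∎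

iter-+ : {n : ℕ} (v : Vec (Fin n) n) (a b : ℕ) (x : Fin n) → iter v (a + b) x ≡ iter v a (iter v b x)
iter-+ v zero    b x = refl
iter-+ v (suc a) b x = cong (lookup v) (iter-+ v a b x)

iter-cancel : {n : ℕ} (v : Vec (Fin n) n) → Inj v →
              ∀ a d x → iter v a x ≡ iter v (a + d) x → x ≡ iter v d x
iter-cancel v v-inj zero    d x e = e
iter-cancel v v-inj (suc a) d x e = iter-cancel v v-inj a d x (v-inj e)

iter-multiple : {n : ℕ} (v : Vec (Fin n) n) (p : ℕ) (x : Fin n) →
                iter v p x ≡ x → ∀ q → iter v (q * p) x ≡ x
iter-multiple v p x e zero    = refl
iter-multiple v p x e (suc q) =
  trans (iter-+ v p (q * p) x) (trans (cong (iter v p) (iter-multiple v p x e q)) e)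

-- Among x, σ x, …, σⁿ x two coincide, so x returns to itself within n steps.
period : {n : ℕ} (v : Vec (Fin n) n) → Inj v → ∀ x → ∃ λ p → 1 ≤ p × p ≤ n × iter v p x ≡ x
period {n} v v-inj x with FinP.pigeonhole (ℕP.n<1+n n) (λ (a : Fin (suc n)) → iter v (toℕ a) x)
... | a , b , a<b , e = d , ℕP.m<n⇒0<n∸m a<b , d≤n ,
  sym (iter-cancel v v-inj (toℕ a) d x
         (trans e (cong (λ t → iter v t x) (sym (ℕP.m+[n∸m]≡n (ℕP.<⇒≤ a<b))))))
  where
  d : ℕ
  d = toℕ b ∸ toℕ a
  d≤n : d ≤ n
  d≤n = ℕP.≤-trans (ℕP.m∸n≤m (toℕ b) (toℕ a)) (ℕP.≤-pred (FinP.toℕ<n b))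

orbit-bound : {n : ℕ} (v : Vec (Fin n) n) → Inj v →
              ∀ x m → ∃ λ m′ → m′ < n × iter v m x ≡ iter v m′ x
orbit-bound v v-inj x m with period v v-inj x
... | suc p , _ , p<n , e = m % suc p , ℕP.<-≤-trans (m%n<n m (suc p)) p<n , (begin
  iter v m x                                   ≡⟨ cong (λ t → iter v t x) (m≡m%n+[m/n]*n m (suc p)) ⟩
  iter v (m % suc p + (m / suc p) * suc p) x   ≡⟨ iter-+ v (m % suc p) _ x ⟩
  iter v (m % suc p) (iter v ((m / suc p) * suc p) x)
    ≡⟨ cong (iter v (m % suc p)) (iter-multiple v (suc p) x e (m / suc p)) ⟩
  iter v (m % suc p) x                         ∎)
  where open ≡-Reasoning

isCycleMin⇔ : {n : ℕ} (v : Vec (Fin n) n) → Inj v → ∀ i →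
              IsCycleMin v i ⇔ (∀ m → toℕ i ≤ toℕ (iter v m i))
isCycleMin⇔ v v-inj i = mk⇔ below-all (λ h → All.tabulate (λ {m} _ → h m))
  where
  below-all : IsCycleMin v i → ∀ m → toℕ i ≤ toℕ (iter v m i)
  below-all min m with orbit-bound v v-inj i m
  ... | m′ , m′<n , e = subst (λ a → toℕ i ≤ toℕ a) (sym e) (All.lookup min (∈P.∈-upTo⁺ m′<n))

-- Cycles: insert τ j  places n+1 into the cycle of τ just before j
-- (as a fixed point when j = n+1), so the number of cycles grows exactly
-- when j = n+1.  This gives the recurrence of the Stirling numbers.
module CycleInsertion (n : ℕ) where

  last : Fin (suc n)
  last = fromℕ n

  -- the entry j is redirected to n+1, which in turn is mapped to j
  redirect : Fin (suc n) → Fin n → Fin (suc n)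
  redirect j y with inject₁ y FinP.≟ j
  ... | yes _ = last
  ... | no  _ = inject₁ y

  redirect-cases : ∀ j y → (inject₁ y ≡ j × redirect j y ≡ last)
                         ⊎ (inject₁ y ≢ j × redirect j y ≡ inject₁ y)
  redirect-cases j y with inject₁ y FinP.≟ j
  ... | yes y≡j = inj₁ (y≡j , refl)
  ... | no  y≢j = inj₂ (y≢j , refl)

  redirect-avoids : ∀ j y → redirect j y ≢ j
  redirect-avoids j y r≡j with redirect-cases j y
  ... | inj₁ (y≡j , r≡last) = FinP.fromℕ≢inject₁ (trans (sym r≡last) (trans r≡j (sym y≡j)))
  ... | inj₂ (y≢j , r≡y)    = y≢j (trans (sym r≡y) r≡j)

  redirect-injective : ∀ j → Injective _≡_ _≡_ (redirect j)
  redirect-injective j {y} {y′} e with redirect-cases j y | redirect-cases j y′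
  ... | inj₁ (y≡j , _)    | inj₁ (y′≡j , _)    = FinP.inject₁-injective (trans y≡j (sym y′≡j))
  ... | inj₁ (_ , r≡last) | inj₂ (_ , r′≡y′)   =
    contradiction (trans (sym r≡last) (trans e r′≡y′)) FinP.fromℕ≢inject₁
  ... | inj₂ (_ , r≡y)    | inj₁ (_ , r′≡last) =
    contradiction (trans (sym r′≡last) (trans (sym e) r≡y)) FinP.fromℕ≢inject₁
  ... | inj₂ (_ , r≡y)    | inj₂ (_ , r′≡y′)   = FinP.inject₁-injective (trans (sym r≡y) (trans e r′≡y′))

  open Insertion redirect redirect-avoids redirect-injective public

  module _ (τ : Vec (Fin n) n) (τ-inj : Inj τ) (j : Fin (suc n)) where

    σ : Vec (Fin (suc n)) (suc n)
    σ = insert τ j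

    InOrbit : Fin n → Fin (suc n) → Set
    InOrbit x a = ∃ λ m → a ≡ inject₁ (iter τ m x) ⊎ (a ≡ last × j ≡ inject₁ (iter τ m x))

    orbit-step : ∀ x a → InOrbit x a → InOrbit x (lookup σ a)
    orbit-step x a (m , inj₁ refl) with redirect-cases j (iter τ (suc m) x)
    ... | inj₁ (y≡j , r≡last) = suc m , inj₂ (trans (insert-inject₁ τ j _) r≡last , sym y≡j)
    ... | inj₂ (_ , r≡y)      = suc m , inj₁ (trans (insert-inject₁ τ j _) r≡y)
    orbit-step x a (m , inj₂ (refl , j≡)) = m , inj₁ (trans (insert-last τ j) j≡)

    orbit : ∀ x m → InOrbit x (iter σ m (inject₁ x))
    orbit x zero    = 0 , inj₁ refl
    orbit x (suc m) = orbit-step x _ (orbit x m)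

    lifted : ∀ x m → ∃ λ m′ → iter σ m′ (inject₁ x) ≡ inject₁ (iter τ m x)
    lifted x zero = 0 , refl
    lifted x (suc m) with lifted x m | redirect-cases j (iter τ (suc m) x)
    ... | m′ , e | inj₁ (y≡j , r≡last) = suc (suc m′) , (begin
      lookup σ (lookup σ (iter σ m′ (inject₁ x)))   ≡⟨ cong (lookup σ ∘ lookup σ) e ⟩
      lookup σ (lookup σ (inject₁ (iter τ m x)))    ≡⟨ cong (lookup σ) (insert-inject₁ τ j _) ⟩
      lookup σ (redirect j (iter τ (suc m) x))      ≡⟨ cong (lookup σ) r≡last ⟩
      lookup σ last                                 ≡⟨ insert-last τ j ⟩
      j                                             ≡⟨ sym y≡j ⟩
      inject₁ (iter τ (suc m) x)                    ∎)
      where open ≡-Reasoning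
    ... | m′ , e | inj₂ (_ , r≡y) =
      suc m′ , trans (cong (lookup σ) e) (trans (insert-inject₁ τ j _) r≡y)

    cycleMin-inject₁ : ∀ x → IsCycleMin σ (inject₁ x) ⇔ IsCycleMin τ x
    cycleMin-inject₁ x = mk⇔
      (λ min → from (isCycleMin⇔ τ τ-inj x) λ m → let (m′ , e) = lifted x m in
        subst₂ _≤_ (FinP.toℕ-inject₁ x) (trans (cong toℕ e) (FinP.toℕ-inject₁ _))
               (to (isCycleMin⇔ σ σ-inj (inject₁ x)) min m′))
      (λ min → from (isCycleMin⇔ σ σ-inj (inject₁ x)) λ m →
        above (to (isCycleMin⇔ τ τ-inj x) min) (orbit x m))
      where
      σ-inj : Inj σ
      σ-inj = insert-Inj τ j τ-inj
      above : (∀ m → toℕ x ≤ toℕ (iter τ m x)) → ∀ {a} → InOrbit x a → toℕ (inject₁ x) ≤ toℕ a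
      above min (m , inj₁ refl)       =
        subst₂ _≤_ (sym (FinP.toℕ-inject₁ x)) (sym (FinP.toℕ-inject₁ _)) (min m)
      above min (m , inj₂ (refl , _)) = FinP.≤fromℕ (inject₁ x)

    cycleMin-last : IsCycleMin σ last ⇔ j ≡ last
    cycleMin-last = mk⇔
      (λ min → FinP.toℕ-injective (ℕP.≤-antisym (FinP.≤fromℕ j)
         (subst (λ a → toℕ last ≤ toℕ a) (insert-last τ j)
                (to (isCycleMin⇔ σ (insert-Inj τ j τ-inj) last) min 1))))
      (λ j≡last → from (isCycleMin⇔ σ (insert-Inj τ j τ-inj) last) λ m →
         subst (λ a → toℕ last ≤ toℕ a) (sym (fixed j≡last m)) ℕP.≤-refl)
      where
      fixed : j ≡ last → ∀ m → iter σ m last ≡ last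
      fixed j≡last zero    = refl
      fixed j≡last (suc m) = trans (cong (lookup σ) (fixed j≡last m)) (trans (insert-last τ j) j≡last)

    cycles-insert : cycles σ ≡ ind (j FinP.≟ last) + cycles τ
    cycles-insert =
      cnt-positions-last (isCycleMin? σ) (isCycleMin? τ) (j FinP.≟ last) cycleMin-inject₁ cycleMin-last

stirling1-recurrence : ∀ n k → stirling1 (suc n) k ≡ 1 * raised cycles n k + n * stirling1 n k
stirling1-recurrence n = insertion-recurrence cycles (FinP._≟ last) cycles-insert 1 n #fixed refl
  where
  open CycleInsertion n
  #fixed : cnt (FinP._≟ last) (allFin (suc n)) ≡ 1
  #fixed = begin
    cnt (FinP._≟ last) (allFin (suc n))
      ≡⟨ cnt-allFin-last (FinP._≟ last) ⟩
    cnt (λ x → inject₁ x FinP.≟ last) (allFin n) + ind (last FinP.≟ last)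
      ≡⟨ cong₂ _+_ (cnt-none _ (λ x e → FinP.fromℕ≢inject₁ (sym e)) (allFin n))
                   (ind-yes (last FinP.≟ last) refl) ⟩
    1 ∎
    where open ≡-Reasoning

-- Left-to-right records.  IsLRMin and IsLRMax are both instances of
-- LeftRecord R (for R = _<_ and R = _>_): the value at i is R-related to the
-- values at all earlier positions.

LeftRecord : {n : ℕ} → (ℕ → ℕ → Set) → Vec (Fin n) n → Fin n → Set
LeftRecord R v i =
  All (λ p → R (toℕ (lookup v i)) (toℕ (lookup v p))) (filter (λ p → toℕ p <? toℕ i) (allFin _))

earlier⇔ : {n : ℕ} {Q : Fin n → Set} (i : Fin n) →
           All Q (filter (λ p → toℕ p <? toℕ i) (allFin n)) ⇔ (∀ p → toℕ p < toℕ i → Q p)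
earlier⇔ {n} i = mk⇔
  (λ all p p<i → All.lookup all (∈P.∈-filter⁺ (λ p → toℕ p <? toℕ i) (∈P.∈-allFin p) p<i))
  (λ h → All.tabulate λ {p} p∈ → h p (proj₂ (∈P.∈-filter⁻ (λ p → toℕ p <? toℕ i) {xs = allFin n} p∈)))

punchIn-<⇔ : {n : ℕ} (j : Fin (suc n)) (a b : Fin n) →
             toℕ a < toℕ b ⇔ toℕ (punchIn j a) < toℕ (punchIn j b)
punchIn-<⇔ j a b = mk⇔
  (λ a<b → ℕP.≰⇒> (λ jb≤ja → ℕP.<⇒≱ a<b (FinP.punchIn-cancel-≤ j b a jb≤ja)))
  (λ ja<jb → ℕP.≰⇒> (λ b≤a → ℕP.<⇒≱ ja<jb (FinP.punchIn-mono-≤ j b a b≤a)))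

punchIn-suc-self : {n : ℕ} (i : Fin n) → punchIn (Fin.suc i) i ≡ inject₁ i
punchIn-suc-self Fin.zero    = refl
punchIn-suc-self (Fin.suc i) = cong Fin.suc (punchIn-suc-self i)

punchIn-inject₁-self : {n : ℕ} (i : Fin n) → punchIn (inject₁ i) i ≡ Fin.suc i
punchIn-inject₁-self Fin.zero    = refl
punchIn-inject₁-self (Fin.suc i) = cong Fin.suc (punchIn-inject₁-self i)

punchIn-fromℕ : {n : ℕ} (i : Fin n) → punchIn (fromℕ n) i ≡ inject₁ i
punchIn-fromℕ Fin.zero    = refl
punchIn-fromℕ (Fin.suc i) = cong Fin.suc (punchIn-fromℕ i)

inject₁<fromℕ : {n : ℕ} (i : Fin n) → toℕ (inject₁ i) < toℕ (fromℕ n)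
inject₁<fromℕ {n} i = subst (toℕ (inject₁ i) <_) (sym (FinP.toℕ-fromℕ n)) (FinP.inject₁ℕ< i)

below-punchIn⇔ : {n : ℕ} (j : Fin (suc n)) → (∀ y → toℕ j < toℕ (punchIn j y)) ⇔ j ≡ Fin.zero
below-punchIn⇔ j = mk⇔ least (λ { refl y → s≤s z≤n })
  where
  least : ∀ {j} → (∀ y → toℕ j < toℕ (punchIn j y)) → j ≡ Fin.zero
  least {Fin.zero}    _     = refl
  least {Fin.suc j′} below = contradiction
    (subst (toℕ (Fin.suc j′) <_) (trans (cong toℕ (punchIn-suc-self j′)) (FinP.toℕ-inject₁ j′)) (below j′))
    (ℕP.<-asym (ℕP.n<1+n (toℕ j′)))

above-punchIn⇔ : {n : ℕ} (j : Fin (suc n)) → (∀ y → toℕ (punchIn j y) < toℕ j) ⇔ j ≡ fromℕ n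
above-punchIn⇔ j = mk⇔ (greatest (view j))
  (λ { refl y → subst (_< toℕ j) (cong toℕ (sym (punchIn-fromℕ y))) (inject₁<fromℕ y) })
  where
  greatest : ∀ {j} → View j → (∀ y → toℕ (punchIn j y) < toℕ j) → j ≡ fromℕ _
  greatest ‵fromℕ       _     = refl
  greatest (‵inject₁ j′) above = contradiction
    (subst₂ _<_ (cong toℕ (punchIn-inject₁-self j′)) (FinP.toℕ-inject₁ j′) (above j′))
    (ℕP.<-asym (ℕP.n<1+n (toℕ j′)))

-- Extreme elements: insert τ j  appends the value j and shifts the values of
-- τ that are ≥ j up by one.  The relative order of the first n entries is
-- unchanged, and the new last entry is extreme iff j is the least or the
-- greatest value.
module ExtremeInsertion (n : ℕ) where

  last : Fin (suc n)
  last = fromℕ n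

  open Insertion {n} punchIn FinP.punchInᵢ≢i (λ j {a} {b} → FinP.punchIn-injective j a b) public

  End : Fin (suc n) → Set
  End j = j ≡ Fin.zero ⊎ j ≡ last

  end? : Decidable End
  end? j = (j FinP.≟ Fin.zero) ⊎-dec (j FinP.≟ last)

  module _ (τ : Vec (Fin n) n) (τ-inj : Inj τ) (j : Fin (suc n)) where

    σ : Vec (Fin (suc n)) (suc n)
    σ = insert τ j

    σ-value : ∀ y → toℕ (lookup σ (inject₁ y)) ≡ toℕ (punchIn j (lookup τ y))
    σ-value y = cong toℕ (insert-inject₁ τ j y)

    record-inject₁ : (R : ℕ → ℕ → Set) →
                     (∀ a b → R (toℕ a) (toℕ b) ⇔ R (toℕ (punchIn j a)) (toℕ (punchIn j b))) →
                     ∀ x → LeftRecord R σ (inject₁ x) ⇔ LeftRecord R τ x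
    record-inject₁ R R-punchIn x = mk⇔
      (λ rec → from (earlier⇔ x) λ y y<x → from (R-punchIn (lookup τ x) (lookup τ y))
        (subst₂ R (σ-value x) (σ-value y) (to (earlier⇔ (inject₁ x)) rec (inject₁ y)
          (subst₂ _<_ (sym (FinP.toℕ-inject₁ y)) (sym (FinP.toℕ-inject₁ x)) y<x))))
      (λ rec → from (earlier⇔ (inject₁ x)) λ p p<x → earlier (to (earlier⇔ x) rec) (view p) p<x)
      where
      earlier : (∀ y → toℕ y < toℕ x → R (toℕ (lookup τ x)) (toℕ (lookup τ y))) →
                ∀ {p} → View p → toℕ p < toℕ (inject₁ x) →
                R (toℕ (lookup σ (inject₁ x))) (toℕ (lookup σ p))
      earlier rec ‵fromℕ        last<x = contradiction last<x (ℕP.<-asym (inject₁<fromℕ x))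
      earlier rec (‵inject₁ y) y<x    = subst₂ R (sym (σ-value x)) (sym (σ-value y))
        (to (R-punchIn (lookup τ x) (lookup τ y))
            (rec y (subst₂ _<_ (FinP.toℕ-inject₁ y) (FinP.toℕ-inject₁ x) y<x)))

    -- since τ is onto, the earlier values are exactly all punchIn j y
    record-last : (R : ℕ → ℕ → Set) → LeftRecord R σ last ⇔ (∀ y → R (toℕ j) (toℕ (punchIn j y)))
    record-last R = mk⇔
      (λ rec y → let (z , τz≡y) = injective⇒surjective (lookup τ) τ-inj y in
        subst₂ R (cong toℕ (insert-last τ j)) (trans (σ-value z) (cong (toℕ ∘ punchIn j) τz≡y))
               (to (earlier⇔ last) rec (inject₁ z) (inject₁<fromℕ z)))
      (λ h → from (earlier⇔ last) λ p p<last → earlier h (view p) p<last)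
      where
      earlier : (∀ y → R (toℕ j) (toℕ (punchIn j y))) →
                ∀ {p} → View p → toℕ p < toℕ last → R (toℕ (lookup σ last)) (toℕ (lookup σ p))
      earlier h ‵fromℕ        last<last = contradiction last<last (ℕP.<-irrefl refl)
      earlier h (‵inject₁ y) _         =
        subst₂ R (cong toℕ (sym (insert-last τ j))) (sym (σ-value y)) (h (lookup τ y))

    extreme-inject₁ : ∀ x → IsExtreme σ (inject₁ x) ⇔ IsExtreme τ x
    extreme-inject₁ x =
      mk⇔ (subst (1 ≤_) (FinP.toℕ-inject₁ x)) (subst (1 ≤_) (sym (FinP.toℕ-inject₁ x)))
      ×-⇔ (record-inject₁ _<_ (punchIn-<⇔ j) x ⊎-⇔ record-inject₁ _>_ (λ a b → punchIn-<⇔ j b a) x)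

    -- the new last position (which is not the first, as n ≥ 1) is extreme
    -- exactly when j is an end value
    extreme-last : 1 ≤ n → IsExtreme σ last ⇔ End j
    extreme-last 1≤n = mk⇔ (to records ∘ proj₂) (λ end → position , from records end)
      where
      position : 1 ≤ toℕ last
      position = subst (1 ≤_) (sym (FinP.toℕ-fromℕ n)) 1≤n
      records : (IsLRMin σ last ⊎ IsLRMax σ last) ⇔ End j
      records = (below-punchIn⇔ j ⇔-∘ record-last _<_) ⊎-⇔ (above-punchIn⇔ j ⇔-∘ record-last _>_)

    extremes-insert : 1 ≤ n → extremes σ ≡ ind (end? j) + extremes τ
    extremes-insert 1≤n =
      cnt-positions-last (isExtreme? σ) (isExtreme? τ) (end? j) extreme-inject₁ (extreme-last 1≤n)

extremes-recurrence : ∀ p k → distribution extremes (suc (suc p)) k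
                              ≡ 2 * raised extremes (suc p) k + p * distribution extremes (suc p) k
extremes-recurrence p =
  insertion-recurrence extremes end? (λ τ τ-inj j → extremes-insert τ τ-inj j (s≤s z≤n)) 2 p #ends refl
  where
  open ExtremeInsertion (suc p)
  #ends : cnt end? (allFin (suc (suc p))) ≡ 2
  #ends = begin
    cnt end? (allFin (suc (suc p)))
      ≡⟨ cnt-allFin-suc end? ⟩
    ind (end? Fin.zero) + cnt (end? ∘ Fin.suc) (allFin (suc p))
      ≡⟨ cong (ind (end? Fin.zero) +_) (cnt-allFin-last (end? ∘ Fin.suc)) ⟩
    ind (end? Fin.zero) + (cnt (end? ∘ Fin.suc ∘ inject₁) (allFin p) + ind (end? last))
      ≡⟨ cong₂ (λ a b → a + (b + ind (end? last)))
               (ind-yes (end? Fin.zero) (inj₁ refl)) (cnt-none _ inner-not-end (allFin p)) ⟩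
    1 + (0 + ind (end? last))
      ≡⟨ cong (λ a → 1 + (0 + a)) (ind-yes (end? last) (inj₂ refl)) ⟩
    2 ∎
    where
    open ≡-Reasoning
    inner-not-end : ∀ y → ¬ End (Fin.suc (inject₁ y))
    inner-not-end y (inj₂ e) = FinP.fromℕ≢inject₁ (sym (FinP.suc-injective e))

extremes-formula : ∀ q k → distribution extremes (suc q) k ≡ 2 ^ k * stirling1 q k
extremes-formula zero    zero    = refl
extremes-formula zero    (suc k) = sym (ℕP.*-zeroʳ (2 ^ suc k))
extremes-formula (suc q) k = begin
  distribution extremes (suc (suc q)) k
    ≡⟨ extremes-recurrence q k ⟩
  2 * raised extremes (suc q) k + q * distribution extremes (suc q) k
    ≡⟨ cong₂ (λ a b → a + q * b) (raised-formula k) (extremes-formula q k) ⟩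
  2 ^ k * raised cycles q k + q * (2 ^ k * stirling1 q k)
    ≡⟨ solve 4 (λ t r q c → t :* r :+ q :* (t :* c) := t :* (con 1 :* r :+ q :* c)) refl
         (2 ^ k) (raised cycles q k) q (stirling1 q k) ⟩
  2 ^ k * (1 * raised cycles q k + q * stirling1 q k)
    ≡⟨ cong (2 ^ k *_) (sym (stirling1-recurrence q k)) ⟩
  2 ^ k * stirling1 (suc q) k ∎
  where
  open ≡-Reasoning
  open +-*-Solver
  raised-formula : ∀ k → 2 * raised extremes (suc q) k ≡ 2 ^ k * raised cycles q k
  raised-formula zero = begin
    2 * raised extremes (suc q) 0   ≡⟨ cong (2 *_) (raised-zero extremes (suc q)) ⟩
    0                               ≡⟨ cong (1 *_) (sym (raised-zero cycles q)) ⟩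
    1 * raised cycles q 0           ∎
  raised-formula (suc k) = begin
    2 * raised extremes (suc q) (suc k)   ≡⟨ cong (2 *_) (raised-suc extremes (suc q) k) ⟩
    2 * distribution extremes (suc q) k   ≡⟨ cong (2 *_) (extremes-formula q k) ⟩
    2 * (2 ^ k * stirling1 q k)           ≡⟨ sym (ℕP.*-assoc 2 (2 ^ k) (stirling1 q k)) ⟩
    2 ^ suc k * stirling1 q k             ≡⟨ cong (2 ^ suc k *_) (sym (raised-suc cycles q k)) ⟩
    2 ^ suc k * raised cycles q (suc k)   ∎

-- Proposition 5.2: for n ≥ k + 1 the number of permutations of [n] with k
-- extreme elements is 2^k c(n-1, k); the bound only rules out n = 0.
proposition5p2 : (n k : ℕ) → 1 ≤ k → k + 1 ≤ n →
    countPerms n (λ σ → extremes σ ≟ k) ≡ 2 ^ k * stirling1 (n ∸ 1) k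
proposition5p2 zero    k _ k+1≤0 = contradiction (ℕP.m+n≤o⇒n≤o k k+1≤0) λ ()
proposition5p2 (suc q) k _ _     = extremes-formula q k
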